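{- Let $G$ be a finite simple $2$-edge connected graph and let $v \in V(G)$ with $d(v) \geq 3$. Then $v$ is contained in a circuit of even length.
   Context: Graphs are finite, simple (no loops, no multiple edges). $d(v)$ denotes the degree of $v$. A graph is $2$-edge connected if it is connected and remains connected whenever fewer than $2$ edges are removed. A walk is a sequence $v_0, e_1, v_1, \ldots, e_k, v_k$ of vertices and edges with $e_i$ having endpoints $v_{i-1}, v_i$; a trail is a walk with no repeated edge; a circuit is a trail whose first and last vertices coincide (vertices may repeat). The length of a circuit is its number of edges. -}

module Defs where

open import Data.Nat using (ℕ; zero; suc; _+_)
open import Data.Bool using (Bool; true; false; if_then_else_)
open import Data.Fin using (Fin)
open import Data.List using (List; []; _∷_; map; length; allFin)
open import Data.Nat.ListAction using (sum)
open import Data.List.Membership.Propositional using (_∈_)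
open import Data.List.Relation.Unary.AllPairs using (AllPairs)
open import Data.Product using (Σ; _×_; _,_; ∃)
open import Data.List.Relation.Unary.All using (All)
open import Data.Sum using (_⊎_)
open import Relation.Nullary using (¬_)
open import Relation.Binary.PropositionalEquality using (_≡_)

record Graph (n : ℕ) : Set where
  field
    adj    : Fin n → Fin n → Bool
    sym    : ∀ x y → adj x y ≡ adj y x
    irrefl : ∀ x → adj x x ≡ false
open Graph public

degree : ∀ {n} → Graph n → Fin n → ℕ
degree {n} G v = sum (map (λ w → if adj G v w then 1 else 0) (allFin n))

data Walk {n : ℕ} (G : Graph n) : Fin n → Fin n → Set where
  nil  : ∀ {u} → Walk G u u
  cons : ∀ {u v w} → adj G u v ≡ true → Walk G v w → Walk G u w

edges : ∀ {n} {G : Graph n} {u w} → Walk G u w → List (Fin n × Fin n)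
edges nil = []
edges (cons {u} {v} _ p) = (u , v) ∷ edges p

vertices : ∀ {n} {G : Graph n} {u w} → Walk G u w → List (Fin n)
vertices {u = u} nil = u ∷ []
vertices (cons {u} _ p) = u ∷ vertices p

walkLength : ∀ {n} {G : Graph n} {u w} → Walk G u w → ℕ
walkLength p = length (edges p)

-- In a simple graph an edge is determined by its (unordered) endpoint pair.
SameEdge : ∀ {n} → Fin n × Fin n → Fin n × Fin n → Set
SameEdge (a , b) (c , d) = (a ≡ c × b ≡ d) ⊎ (a ≡ d × b ≡ c)

IsTrail : ∀ {n} {G : Graph n} {u w} → Walk G u w → Set
IsTrail p = AllPairs (λ e f → ¬ SameEdge e f) (edges p)

record Circuit {n : ℕ} (G : Graph n) : Set where
  field
    base  : Fin n
    walk  : Walk G base base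
    trail : IsTrail walk
    nonempty : ¬ (walkLength walk ≡ 0)
open Circuit public

Connected : ∀ {n} → Graph n → Set
Connected {n} G = ∀ (u w : Fin n) → Walk G u w

-- G - e is connected, for e = {a,b}: any two vertices are joined by a walk
-- of G that does not use the edge {a,b} (i.e. a walk in G - e).
ConnectedWithout : ∀ {n} → Graph n → Fin n → Fin n → Set
ConnectedWithout {n} G a b =
  ∀ (u w : Fin n) → Σ (Walk G u w) (λ p → All (λ e → ¬ SameEdge (a , b) e) (edges p))

TwoEdgeConnected : ∀ {n} → Graph n → Set
TwoEdgeConnected {n} G =
  Connected G × (∀ (a b : Fin n) → adj G a b ≡ true → ConnectedWithout G a b)

-- Split a closed trail C through v at the point x where a second trail R from v first meets it,
-- C = A ++ B with A : v → x and B : x → v.  With R edge-disjoint from C this gives three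
-- edge-disjoint trails between v and x, and two of the lengths |A|, |B|, |R| have the same
-- parity, so one of the circuits A B, R B, R A⁻¹ through v is even.  Such C and R exist: take a
-- neighbour a of v and close a path from v to a avoiding the edge va; then take a third neighbour
-- c of v, different from a and from the second vertex of that path, and walk from v along vc and
-- then along a path from c back to v avoiding vc, up to its first vertex on C.
module Submission where

open import Defs hiding (sym)
open import Data.Bool using (true; false; if_then_else_)
import Data.Bool.Properties as Bool
open import Data.Empty using (⊥-elim)
open import Data.Fin using (Fin; zero; suc)
open import Data.Fin.Properties using (_≟_; any?)
open import Data.List using (List; []; _∷_; _++_; map; length; tabulate; allFin)
open import Data.List.Properties using (length-++; map-tabulate)
open import Data.List.Membership.Propositional using (_∈_; _∉_)
import Data.List.Membership.DecPropositional as DecMembership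
open import Data.List.Membership.Propositional.Properties using (∈-++⁺ʳ; ∈-++⁻)
open import Data.List.Relation.Binary.Subset.Propositional using (_⊆_)
open import Data.List.Relation.Unary.All as All using (All; []; _∷_)
open import Data.List.Relation.Unary.All.Properties using (¬Any⇒All¬; All¬⇒¬Any)
import Data.List.Relation.Unary.All.Properties as All
open import Data.List.Relation.Unary.AllPairs using (AllPairs; []; _∷_)
open import Data.List.Relation.Unary.AllPairs.Properties using (++⁺)
open import Data.List.Relation.Unary.Any using (here; there)
open import Data.Nat using (ℕ; zero; suc; _+_; _≤_; z≤n; s≤s)
open import Data.Nat.Divisibility using (_∣_; divides)
open import Data.Nat.ListAction using (sum)
open import Data.Nat.Properties using (+-comm; +-mono-≤; <⇒≱; m+n≡0⇒m≡0; +-commutativeSemigroup)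
open import Algebra.Properties.CommutativeSemigroup +-commutativeSemigroup using (interchange)
open import Data.Parity.Base as ℙ using (Parity; 0ℙ; 1ℙ)
open import Data.Nat.Base using (parity)
open import Data.Parity.Properties using (+-homo-+; p+p≡0ℙ)
open import Data.Product using (Σ; ∃-syntax; _×_; _,_; proj₁; proj₂; swap)
import Data.Product as Product
open import Data.Sum using (_⊎_; inj₁; inj₂)
import Data.Sum as Sum
open import Function using (_∘_; id)
open import Relation.Nullary using (¬_; yes; no; does)
open import Relation.Nullary.Decidable using (_×-dec_; ¬?)
open import Relation.Binary.PropositionalEquality
  using (_≡_; _≢_; refl; sym; trans; cong; cong₂; subst; module ≡-Reasoning)

private
  variable
    n : ℕ
    A : Set

parity≡0ℙ⇒2∣ : ∀ m → parity m ≡ 0ℙ → 2 ∣ m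
parity≡0ℙ⇒2∣ zero          _  = divides 0 refl
parity≡0ℙ⇒2∣ (suc zero)    ()
parity≡0ℙ⇒2∣ (suc (suc m)) eq with parity≡0ℙ⇒2∣ m eq
... | divides q m≡q*2 = divides (suc q) (cong (2 +_) m≡q*2)

parity≡⇒2∣+ : ∀ m k → parity m ≡ parity k → 2 ∣ m + k
parity≡⇒2∣+ m k eq = parity≡0ℙ⇒2∣ (m + k) (begin
  parity (m + k)          ≡⟨ +-homo-+ m k ⟩
  parity m ℙ.+ parity k   ≡⟨ cong (parity m ℙ.+_) (sym eq) ⟩
  parity m ℙ.+ parity m   ≡⟨ p+p≡0ℙ (parity m) ⟩
  0ℙ                      ∎)
  where open ≡-Reasoning

parity-pigeonhole : ∀ (p q r : Parity) → p ≡ q ⊎ p ≡ r ⊎ q ≡ r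
parity-pigeonhole 0ℙ 0ℙ _  = inj₁ refl
parity-pigeonhole 1ℙ 1ℙ _  = inj₁ refl
parity-pigeonhole 0ℙ 1ℙ 0ℙ = inj₂ (inj₁ refl)
parity-pigeonhole 1ℙ 0ℙ 1ℙ = inj₂ (inj₁ refl)
parity-pigeonhole 0ℙ 1ℙ 1ℙ = inj₂ (inj₂ refl)
parity-pigeonhole 1ℙ 0ℙ 0ℙ = inj₂ (inj₂ refl)

2∣-some-pair-sum : ∀ a b c → 2 ∣ a + b ⊎ 2 ∣ a + c ⊎ 2 ∣ b + c
2∣-some-pair-sum a b c =
  Sum.map (parity≡⇒2∣+ a b) (Sum.map (parity≡⇒2∣+ a c) (parity≡⇒2∣+ b c))
    (parity-pigeonhole (parity a) (parity b) (parity c))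

sum-map-≤-+ : (f g h : A → ℕ) → (∀ a → f a ≤ g a + h a) →
  ∀ xs → sum (map f xs) ≤ sum (map g xs) + sum (map h xs)
sum-map-≤-+ f g h f≤g+h []       = z≤n
sum-map-≤-+ f g h f≤g+h (x ∷ xs) = subst (sum (map f (x ∷ xs)) ≤_)
  (interchange (g x) (h x) (sum (map g xs)) (sum (map h xs)))
  (+-mono-≤ (f≤g+h x) (sum-map-≤-+ f g h f≤g+h xs))

δ : Fin n → Fin n → ℕ
δ x w = if does (w ≟ x) then 1 else 0

sum-tabulate-0 : ∀ n → sum (tabulate {n = n} (λ _ → 0)) ≡ 0
sum-tabulate-0 zero    = refl
sum-tabulate-0 (suc n) = sum-tabulate-0 n

sum-tabulate-δ : (x : Fin n) → sum (tabulate (δ x)) ≡ 1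
sum-tabulate-δ {suc n} zero    = cong suc (sum-tabulate-0 n)
sum-tabulate-δ         (suc x) = sum-tabulate-δ x

sum-allFin-δ : (x : Fin n) → sum (map (δ x) (allFin n)) ≡ 1
sum-allFin-δ x = trans (cong sum (map-tabulate id (δ x))) (sum-tabulate-δ x)

AllPairs-++⁻ : ∀ {R : A → A → Set} xs {ys} → AllPairs R (xs ++ ys) →
  AllPairs R xs × AllPairs R ys × All (λ x → All (R x) ys) xs
AllPairs-++⁻ []       pys          = [] , pys , []
AllPairs-++⁻ (x ∷ xs) (px ∷ pxsys) with AllPairs-++⁻ xs pxsys
... | pxs , pys , pxs-ys = All.++⁻ˡ xs px ∷ pxs , pys , All.++⁻ʳ xs px ∷ pxs-ys

Distinct : Fin n × Fin n → Fin n × Fin n → Set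
Distinct e f = ¬ SameEdge e f

EdgeDisjoint : List (Fin n × Fin n) → List (Fin n × Fin n) → Set
EdgeDisjoint es fs = All (λ e → All (Distinct e) fs) es

SameEdge-sym : ∀ {e f : Fin n × Fin n} → SameEdge e f → SameEdge f e
SameEdge-sym (inj₁ (p , q)) = inj₁ (sym p , sym q)
SameEdge-sym (inj₂ (p , q)) = inj₂ (sym q , sym p)

SameEdge-swapʳ : ∀ {e f : Fin n × Fin n} → SameEdge e f → SameEdge e (swap f)
SameEdge-swapʳ (inj₁ (p , q)) = inj₂ (p , q)
SameEdge-swapʳ (inj₂ (p , q)) = inj₁ (p , q)

EdgeDisjoint-++⁻ʳ : ∀ {es} fs {gs} → EdgeDisjoint {n} es (fs ++ gs) →
  EdgeDisjoint es fs × EdgeDisjoint es gs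
EdgeDisjoint-++⁻ʳ fs = All.unzip ∘ All.map (All.++⁻ fs)

Distinct-∉ : ∀ {S} {e f : Fin n × Fin n} →
  proj₁ e ∉ S → proj₁ f ∈ S × proj₂ f ∈ S → Distinct e f
Distinct-∉ e∉S (f₁∈S , _) (inj₁ (refl , _)) = e∉S f₁∈S
Distinct-∉ e∉S (_ , f₂∈S) (inj₂ (refl , _)) = e∉S f₂∈S

module _ (G : Graph n) where

  adj⇒≢ : ∀ {u w} → adj G u w ≡ true → u ≢ w
  adj⇒≢ {u} uw refl with () ← trans (sym uw) (irrefl G u)

  adj-sym : ∀ {u w} → adj G u w ≡ true → adj G w u ≡ true
  adj-sym {u} {w} uw = trans (Graph.sym G w u) uw

  degree≤2 : ∀ {v} x y → (∀ w → adj G v w ≡ true → w ≡ x ⊎ w ≡ y) → degree G v ≤ 2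
  degree≤2 {v} x y nbrs = subst (degree G v ≤_)
    (cong₂ _+_ (sum-allFin-δ x) (sum-allFin-δ y))
    (sum-map-≤-+ _ (δ x) (δ y) bound (allFin n))
    where
    bound : ∀ w → (if adj G v w then 1 else 0) ≤ δ x w + δ y w
    bound w with adj G v w in vw | w ≟ x | w ≟ y
    ... | false | _     | _     = z≤n
    ... | true  | yes _ | _     = s≤s z≤n
    ... | true  | no _  | yes _ = s≤s z≤n
    ... | true  | no w≢x | no w≢y = ⊥-elim (Sum.[ w≢x , w≢y ] (nbrs w vw))

  neighbour-avoiding : ∀ {v} → 3 ≤ degree G v → ∀ x y →
    ∃[ c ] adj G v c ≡ true × c ≢ x × c ≢ y
  neighbour-avoiding {v} 3≤d x y
    with any? (λ c → (adj G v c Bool.≟ true) ×-dec ¬? (c ≟ x) ×-dec ¬? (c ≟ y))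
  ... | yes found = found
  ... | no none   = ⊥-elim (<⇒≱ 3≤d (degree≤2 x y nbrs))
    where
    nbrs : ∀ w → adj G v w ≡ true → w ≡ x ⊎ w ≡ y
    nbrs w vw with w ≟ x | w ≟ y
    ... | yes w≡x | _       = inj₁ w≡x
    ... | no _    | yes w≡y = inj₂ w≡y
    ... | no w≢x  | no w≢y  = ⊥-elim (none (w , vw , w≢x , w≢y))

  open DecMembership (_≟_ {n}) using (_∈?_)

  infixr 5 _++ʷ_
  _++ʷ_ : ∀ {u x w} → Walk G u x → Walk G x w → Walk G u w
  nil      ++ʷ q = q
  cons e p ++ʷ q = cons e (p ++ʷ q)

  edges-++ʷ : ∀ {u x w} (p : Walk G u x) (q : Walk G x w) → edges (p ++ʷ q) ≡ edges p ++ edges q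
  edges-++ʷ nil                q = refl
  edges-++ʷ (cons {u} {y} e p) q = cong ((u , y) ∷_) (edges-++ʷ p q)

  walkLength-++ʷ : ∀ {u x w} (p : Walk G u x) (q : Walk G x w) →
    walkLength (p ++ʷ q) ≡ walkLength p + walkLength q
  walkLength-++ʷ p q = trans (cong length (edges-++ʷ p q)) (length-++ (edges p))

  IsTrail-++ʷ : ∀ {u x w} (p : Walk G u x) (q : Walk G x w) →
    IsTrail p → IsTrail q → EdgeDisjoint (edges p) (edges q) → IsTrail (p ++ʷ q)
  IsTrail-++ʷ p q tp tq d = subst (AllPairs Distinct) (sym (edges-++ʷ p q)) (++⁺ tp tq d)

  IsTrail-++ʷ⁻ : ∀ {u x w} (p : Walk G u x) (q : Walk G x w) →
    IsTrail (p ++ʷ q) → IsTrail p × IsTrail q × EdgeDisjoint (edges p) (edges q)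
  IsTrail-++ʷ⁻ p q t = AllPairs-++⁻ (edges p) (subst (AllPairs Distinct) (edges-++ʷ p q) t)

  reverseʷ : ∀ {u w} → Walk G u w → Walk G w u
  reverseʷ nil        = nil
  reverseʷ (cons e p) = reverseʷ p ++ʷ cons (adj-sym e) nil

  ∈-edges-reverseʷ : ∀ {u w e} (p : Walk G u w) → e ∈ edges (reverseʷ p) → swap e ∈ edges p
  ∈-edges-reverseʷ (cons e p) e∈
    with ∈-++⁻ (edges (reverseʷ p)) (subst (_ ∈_) (edges-++ʷ (reverseʷ p) _) e∈)
  ... | inj₁ e∈p         = there (∈-edges-reverseʷ p e∈p)
  ... | inj₂ (here refl) = here refl

  walkLength-reverseʷ : ∀ {u w} (p : Walk G u w) → walkLength (reverseʷ p) ≡ walkLength p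
  walkLength-reverseʷ nil        = refl
  walkLength-reverseʷ (cons e p) = begin
    walkLength (reverseʷ p ++ʷ cons (adj-sym e) nil) ≡⟨ walkLength-++ʷ (reverseʷ p) _ ⟩
    walkLength (reverseʷ p) + 1                      ≡⟨ cong (_+ 1) (walkLength-reverseʷ p) ⟩
    walkLength p + 1                                 ≡⟨ +-comm (walkLength p) 1 ⟩
    suc (walkLength p)                               ∎
    where open ≡-Reasoning

  IsTrail-reverseʷ : ∀ {u w} (p : Walk G u w) → IsTrail p → IsTrail (reverseʷ p)
  IsTrail-reverseʷ nil        [] = []
  IsTrail-reverseʷ (cons e p) (e∉p ∷ tp) =
    IsTrail-++ʷ (reverseʷ p) _ (IsTrail-reverseʷ p tp) ([] ∷ [])
      (All.tabulate λ f∈ → (λ same → All.lookup e∉p (∈-edges-reverseʷ p f∈)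
        (SameEdge-swapʳ (SameEdge-sym (SameEdge-swapʳ same)))) ∷ [])

  EdgeDisjoint-reverseʷ : ∀ {u w} {es} (p : Walk G u w) →
    EdgeDisjoint es (edges p) → EdgeDisjoint es (edges (reverseʷ p))
  EdgeDisjoint-reverseʷ p = All.map λ e∉p →
    All.tabulate λ f∈ same → All.lookup e∉p (∈-edges-reverseʷ p f∈) (SameEdge-swapʳ same)

  head∈vertices : ∀ {u w} (p : Walk G u w) → u ∈ vertices p
  head∈vertices nil        = here refl
  head∈vertices (cons e p) = here refl

  endpoints∈vertices : ∀ {u w e} (p : Walk G u w) → e ∈ edges p →
    proj₁ e ∈ vertices p × proj₂ e ∈ vertices p
  endpoints∈vertices (cons e p) (here refl) = here refl , there (head∈vertices p)
  endpoints∈vertices (cons e p) (there f∈p) =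
    Product.map there there (endpoints∈vertices p f∈p)

  ∉vertices⇒Distinct-edges : ∀ {u w e} (p : Walk G u w) → proj₁ e ∉ vertices p →
    All (Distinct e) (edges p)
  ∉vertices⇒Distinct-edges p e∉p =
    All.tabulate λ f∈p → Distinct-∉ e∉p (endpoints∈vertices p f∈p)

  IsPath : ∀ {u w} → Walk G u w → Set
  IsPath p = AllPairs _≢_ (vertices p)

  IsPath⇒IsTrail : ∀ {u w} (p : Walk G u w) → IsPath p → IsTrail p
  IsPath⇒IsTrail nil                _          = []
  IsPath⇒IsTrail (cons {u} {y} e p) (u∉p ∷ pp) =
    ∉vertices⇒Distinct-edges p (All¬⇒¬Any u∉p) ∷ IsPath⇒IsTrail p pp

  IsPath-++ʷʳ : ∀ {u x w} (p : Walk G u x) {q : Walk G x w} → IsPath (p ++ʷ q) → IsPath q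
  IsPath-++ʷʳ nil        pq       = pq
  IsPath-++ʷʳ (cons e p) (_ ∷ pq) = IsPath-++ʷʳ p pq

  record Split {u w} (p : Walk G u w) (x : Fin n) : Set where
    constructor split
    field
      prefix : Walk G u x
      suffix : Walk G x w
      p≡prefix++suffix : p ≡ prefix ++ʷ suffix

  splitAt : ∀ {u w x} (p : Walk G u w) → x ∈ vertices p → Split p x
  splitAt nil        (here refl) = split nil nil refl
  splitAt (cons e p) (here refl) = split nil (cons e p) refl
  splitAt (cons e p) (there x∈p) with splitAt p x∈p
  ... | split p₁ p₂ p≡ = split (cons e p₁) p₂ (cong (cons e) p≡)

  firstEntry : ∀ {u w} (S : List (Fin n)) (q : Walk G u w) → w ∈ S →
    ∃[ x ] x ∈ S × Σ (Split q x) λ s → All (λ e → proj₁ e ∉ S) (edges (Split.prefix s))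
  firstEntry {u} S q w∈S with u ∈? S
  firstEntry S q          w∈S | yes u∈S = _ , u∈S , split nil q refl , []
  firstEntry S nil        w∈S | no u∉S  = _ , w∈S , split nil nil refl , []
  firstEntry S (cons e q) w∈S | no u∉S with firstEntry S q w∈S
  ... | x , x∈S , split q₁ q₂ q≡ , q₁-outside =
    x , x∈S , split (cons e q₁) q₂ (cong (cons e) q≡) , u∉S ∷ q₁-outside

  toPath : ∀ {u w} (p : Walk G u w) → Σ (Walk G u w) λ q → IsPath q × edges q ⊆ edges p
  toPath nil = nil , [] ∷ [] , id
  toPath (cons {u} e p) with toPath p
  ... | q , q-path , q⊆p with u ∈? vertices q
  ...   | no u∉q  = cons e q , ¬Any⇒All¬ (vertices q) u∉q ∷ q-path , head-or-tail
    where
    head-or-tail : edges (cons e q) ⊆ edges (cons e p)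
    head-or-tail (here refl) = here refl
    head-or-tail (there f∈q) = there (q⊆p f∈q)
  ...   | yes u∈q with splitAt q u∈q
  ...     | split q₁ q₂ refl = q₂ , IsPath-++ʷʳ q₁ q-path , there ∘ q⊆p ∘ suffix⊆
    where
    suffix⊆ : edges q₂ ⊆ edges (q₁ ++ʷ q₂)
    suffix⊆ f∈q₂ = subst (_ ∈_) (sym (edges-++ʷ q₁ q₂)) (∈-++⁺ʳ (edges q₁) f∈q₂)

  EvenCircuitThrough : Fin n → Set
  EvenCircuitThrough v = Σ (Circuit G) λ C → v ∈ vertices (walk C) × 2 ∣ walkLength (walk C)

  evenClosedTrail : ∀ {v x} (p : Walk G v x) (q : Walk G x v) →
    IsTrail p → IsTrail q → EdgeDisjoint (edges p) (edges q) →
    walkLength (p ++ʷ q) ≢ 0 → 2 ∣ walkLength p + walkLength q → EvenCircuitThrough v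
  evenClosedTrail p q tp tq d p++q≢0 even =
    record { walk = p ++ʷ q ; trail = IsTrail-++ʷ p q tp tq d ; nonempty = p++q≢0 } ,
    head∈vertices (p ++ʷ q) ,
    subst (2 ∣_) (sym (walkLength-++ʷ p q)) even

  walkLength-++ʷ≢0 : ∀ {u x w} (p : Walk G u x) (q : Walk G x w) →
    walkLength p ≢ 0 → walkLength (p ++ʷ q) ≢ 0
  walkLength-++ʷ≢0 p q p≢0 =
    p≢0 ∘ m+n≡0⇒m≡0 (walkLength p) ∘ trans (sym (walkLength-++ʷ p q))

  evenCircuit-of-chord : ∀ {v x} (C : Walk G v v) (R : Walk G v x) →
    IsTrail C → IsTrail R → EdgeDisjoint (edges R) (edges C) →
    walkLength C ≢ 0 → walkLength R ≢ 0 → x ∈ vertices C → EvenCircuitThrough v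
  evenCircuit-of-chord C R tC tR dRC C≢0 R≢0 x∈C with splitAt C x∈C
  ... | split A B refl with IsTrail-++ʷ⁻ A B tC
  ...   | tA , tB , dAB
    with EdgeDisjoint-++⁻ʳ (edges A) (subst (EdgeDisjoint (edges R)) (edges-++ʷ A B) dRC)
  ...     | dRA , dRB with 2∣-some-pair-sum (walkLength R) (walkLength A) (walkLength B)
  ...       | inj₁ even = evenClosedTrail R (reverseʷ A) tR (IsTrail-reverseʷ A tA)
                (EdgeDisjoint-reverseʷ A dRA) (walkLength-++ʷ≢0 R _ R≢0)
                (subst (λ l → 2 ∣ walkLength R + l) (sym (walkLength-reverseʷ A)) even)
  ...       | inj₂ (inj₁ even) = evenClosedTrail R B tR tB dRB (walkLength-++ʷ≢0 R B R≢0) even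
  ...       | inj₂ (inj₂ even) = evenClosedTrail A B tA tB dAB C≢0 even

  pathAvoiding : TwoEdgeConnected G → ∀ {a b} → adj G a b ≡ true → ∀ s t →
    Σ (Walk G s t) λ p → IsPath p × All (Distinct (a , b)) (edges p)
  pathAvoiding (_ , bridgeless) ab s t with bridgeless _ _ ab s t
  ... | p , p-avoids with toPath p
  ...   | q , q-path , q⊆p = q , q-path , All.anti-mono q⊆p p-avoids

  close : ∀ {u w} → Walk G u w → adj G u w ≡ true → Walk G u u
  close p uw = p ++ʷ cons (adj-sym uw) nil

  IsTrail-close : ∀ {u w} (p : Walk G u w) (uw : adj G u w ≡ true) →
    IsTrail p → All (Distinct (u , w)) (edges p) → IsTrail (close p uw)
  IsTrail-close p uw tp p-avoids = IsTrail-++ʷ p _ tp ([] ∷ [])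
    (All.map (λ uw≢f → (uw≢f ∘ SameEdge-sym ∘ SameEdge-swapʳ) ∷ []) p-avoids)

  evenCircuit-of-paths : ∀ {v p₁ a c}
    (va : adj G v a ≡ true) (vp₁ : adj G v p₁ ≡ true) (P : Walk G p₁ a) →
    IsPath (cons vp₁ P) → All (Distinct (v , a)) (edges (cons vp₁ P)) →
    (vc : adj G v c ≡ true) → c ≢ a → c ≢ p₁ →
    (Q : Walk G c v) → IsTrail Q → All (Distinct (v , c)) (edges Q) →
    EvenCircuitThrough v
  evenCircuit-of-paths {v} {p₁} {a} {c}
    va vp₁ P P-path@(v∉P ∷ _) P-avoids vc c≢a c≢p₁ Q tQ Q-avoids
    with firstEntry (vertices (close (cons vp₁ P) va)) Q (here refl)
  ... | x , x∈C , split Q₁ Q₂ refl , Q₁-outside =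
    evenCircuit-of-chord C R
      (IsTrail-close (cons vp₁ P) va (IsPath⇒IsTrail (cons vp₁ P) P-path) P-avoids)
      (All.++⁻ˡ (edges Q₁) (subst (All (Distinct (v , c))) (edges-++ʷ Q₁ Q₂) Q-avoids)
        ∷ proj₁ (IsTrail-++ʷ⁻ Q₁ Q₂ tQ))
      (vc∉C ∷ All.map (∉vertices⇒Distinct-edges C) Q₁-outside)
      (λ ()) (λ ()) x∈C
    where
    C : Walk G v v
    C = close (cons vp₁ P) va
    R : Walk G v x
    R = cons vc Q₁

    vc≢vp₁ : Distinct (v , c) (v , p₁)
    vc≢vp₁ (inj₁ (_ , c≡p₁)) = c≢p₁ c≡p₁
    vc≢vp₁ (inj₂ (_ , c≡v))  = adj⇒≢ vc (sym c≡v)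

    vc≢av : Distinct (v , c) (a , v)
    vc≢av (inj₁ (_ , c≡v)) = adj⇒≢ vc (sym c≡v)
    vc≢av (inj₂ (_ , c≡a)) = c≢a c≡a

    vc∉C : All (Distinct (v , c)) (edges C)
    vc∉C = vc≢vp₁ ∷ subst (All (Distinct (v , c))) (sym (edges-++ʷ P _))
      (All.++⁺ (∉vertices⇒Distinct-edges P (All¬⇒¬Any v∉P)) (vc≢av ∷ []))

theorem8 : ∀ {n : ℕ} (G : Graph n) → TwoEdgeConnected G → (v : Fin n) → 3 ≤ degree G v →
    Σ (Circuit G) (λ C → (v ∈ vertices (walk C)) × (2 ∣ walkLength (walk C)))
theorem8 G tec v 3≤d with neighbour-avoiding G 3≤d v v
... | a , va , _ with pathAvoiding G tec va v a
...   | nil , _ = ⊥-elim (adj⇒≢ G va refl)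
...   | cons vp₁ P , P-path , P-avoids with neighbour-avoiding G 3≤d a _
...     | c , vc , c≢a , c≢p₁ with pathAvoiding G tec vc c v
...       | Q , Q-path , Q-avoids =
  evenCircuit-of-paths G va vp₁ P P-path P-avoids vc c≢a c≢p₁ Q (IsPath⇒IsTrail G Q Q-path) Q-avoids
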